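{- A language $L\subseteq\{0,1\}^*$ is in $NP/poly\cap coNP/poly$ if and only if, letting $f_n\in B_n$ be the characteristic function of $L\cap\{0,1\}^n$, there is a polynomial $p$ such that $|\mathcal{T}(f_n)|\le p(n)$ for all $n$.
   Context: $NP/poly$ (resp. $coNP/poly$) is the class of languages decided by polynomial-size families of non-deterministic (resp. co-non-deterministic) circuits with fan-in two $\land$, $\lor$ gates and $\neg$ gates; a non-deterministic circuit $C(x,y)$ accepts $x$ iff some $y$ gives $C(x,y)=1$, and a co-non-deterministic circuit rejects $x$ iff some $y$ gives $C(x,y)=0$. $B_k$ is the set of Boolean functions $\{0,1\}^k\to\{0,1\}$. For $f\in B_n$, enumerate $\{0,1\}^n$ lexicographically as $a^1,\dots,a^{2^n}$; the truth table $f^{\bullet}$ is the $2^n\times(n+1)$ matrix with rows $(a^j,f(a^j))$. Vectors in $\{0,1\}^{2^n}$ are called columns; the columns of $f^{\bullet}$ are $x_1,\dots,x_n$ ($x_i[j]=a^j_i$) and $r$ ($r[j]=f(a^j)$). For $w\in B_{2^n}$ and a column $v$, $w(v)=w(v[1],\dots,v[2^n])$. $\overline{Pol}(f^{\bullet})$ is the set of $w\in B_{2^n}$ with $w(r)\ne f(w(x_1),\dots,w(x_n))$. An $\land$-gate is a triple $(u,v,z)$ of columns with $z=u\land v$ componentwise, an $\lor$-gate a triple with $z=u\lor v$, a $\neg$-gate a pair $(u,z)$ with $z=\neg u$; the gate covers $w\in B_{2^n}$ if $w$ applied to its columns violates its operation (e.g. $w(z)\ne w(u)\land w(v)$). A $Pol$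 cover for $f$ is a collection of gates covering every $w\in\overline{Pol}(f^{\bullet})$; $|\mathcal{T}(f)|$ is the minimum number of gates in a $Pol$ cover for $f$. -}

module Defs where

open import Data.Bool using (Bool; true; false; _∧_; _∨_; not)
open import Data.Nat using (ℕ; zero; suc; _+_; _*_; _^_; _≤_)
open import Data.Fin using (Fin)
open import Data.Vec using (Vec; []; _∷_; _++_; map; lookup; tabulate; zipWith)
open import Data.List using (List; length)
open import Data.List.Membership.Propositional using (_∈_)
open import Data.Product using (Σ; ∃; _×_)
open import Relation.Binary.PropositionalEquality using (_≡_; _≢_)
open import Function.Bundles using (_⇔_)

Poly : Set
Poly = List ℕ

evalPoly : Poly → ℕ → ℕ
evalPoly List.[] n = 0
evalPoly (c List.∷ cs) n = c + n * evalPoly cs n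

Language : Set
Language = List Bool → Bool

charFun : Language → (n : ℕ) → Vec Bool n → Bool
charFun L n x = L (Data.Vec.toList x)

-- A gate over k available wires reads existing wires;
-- 'Circuit k' is a straight-line program: a sequence of gates, each new
-- gate adding one wire (prepended, de Bruijn style), ending with a
-- choice of output wire.

data Gate (k : ℕ) : Set where
  andG : Fin k → Fin k → Gate k
  orG  : Fin k → Fin k → Gate k
  notG : Fin k → Gate k

evalGate : ∀ {k} → Gate k → Vec Bool k → Bool
evalGate (andG i j) v = lookup v i ∧ lookup v j
evalGate (orG i j)  v = lookup v i ∨ lookup v j
evalGate (notG i)   v = not (lookup v i)

data Circuit (k : ℕ) : Set where
  out  : Fin k → Circuit k
  _▷_  : Gate k → Circuit (suc k) → Circuit k

size : ∀ {k} → Circuit k → ℕ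
size (out _) = 0
size (g ▷ c) = suc (size c)

eval : ∀ {k} → Circuit k → Vec Bool k → Bool
eval (out i) v = lookup v i
eval (g ▷ c) v = eval c (evalGate g v ∷ v)

-- A (co-)non-deterministic circuit for length n is a circuit C(x,y) on
-- n + k inputs (x : n bits, y : k non-deterministic bits).

InNPpoly : Language → Set
InNPpoly L = Σ Poly λ p → (n : ℕ) → Σ ℕ λ k → Σ (Circuit (n + k)) λ C →
  (size C + k ≤ evalPoly p n) ×
  ((x : Vec Bool n) → (L (Data.Vec.toList x) ≡ true) ⇔ (Σ (Vec Bool k) λ y → eval C (x ++ y) ≡ true))

InCoNPpoly : Language → Set
InCoNPpoly L = Σ Poly λ p → (n : ℕ) → Σ ℕ λ k → Σ (Circuit (n + k)) λ C →
  (size C + k ≤ evalPoly p n) ×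
  ((x : Vec Bool n) → (L (Data.Vec.toList x) ≡ false) ⇔ (Σ (Vec Bool k) λ y → eval C (x ++ y) ≡ false))

-- {0,1}^n enumerated lexicographically (false < true, first coordinate
-- most significant): a¹, …, a^{2ⁿ}.
-- (2 ^ suc n = 2 ^ n + (2 ^ n + 0) definitionally.)
rows : (n : ℕ) → Vec (Vec Bool n) (2 ^ n)
rows zero = [] ∷ []
rows (suc n) = map (false ∷_) (rows n) ++ (map (true ∷_) (rows n) ++ [])

Column : ℕ → Set
Column n = Vec Bool (2 ^ n)

xCol : (n : ℕ) → Fin n → Column n
xCol n i = map (λ a → lookup a i) (rows n)

rCol : (n : ℕ) → (Vec Bool n → Bool) → Column n
rCol n f = map f (rows n)

B : ℕ → Set
B m = Vec Bool m → Bool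

InPolBar : (n : ℕ) → (Vec Bool n → Bool) → B (2 ^ n) → Set
InPolBar n f w = w (rCol n f) ≢ f (tabulate λ i → w (xCol n i))

-- gates on columns; the output column z is determined by the inputs
-- (z = u ∧ v, z = u ∨ v, z = ¬u componentwise).
data ColGate (n : ℕ) : Set where
  andC : Column n → Column n → ColGate n
  orC  : Column n → Column n → ColGate n
  notC : Column n → ColGate n

Covers : ∀ {n} → ColGate n → B (2 ^ n) → Set
Covers (andC u v) w = w (zipWith _∧_ u v) ≢ (w u ∧ w v)
Covers (orC u v)  w = w (zipWith _∨_ u v) ≢ (w u ∨ w v)
Covers (notC u)   w = w (map not u) ≢ not (w u)

IsPolCover : (n : ℕ) → (Vec Bool n → Bool) → List (ColGate n) → Set
IsPolCover n f gs = (w : B (2 ^ n)) → InPolBar n f w → ∃ λ g → g ∈ gs × Covers g w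

-- |T(f)| ≤ m : the minimum size of a Pol cover is at most m,
-- i.e. some Pol cover for f has at most m gates.
TSize≤ : (n : ℕ) → (Vec Bool n → Bool) → ℕ → Set
TSize≤ n f m = Σ (List (ColGate n)) λ gs → IsPolCover n f gs × length gs ≤ m

-- Run a certificate circuit C(x, y) for "f x ≡ b" gate by gate on the truth-table columns x₁ … xₙ
-- together with columns of chosen witnesses: its output column is r, and each of its gates becomes
-- a gate on columns.  A w ∈ B_{2ⁿ} covered by none of these commutes with C, so w(r) ≡ b forces
-- f(w(x₁), …, w(xₙ)) ≡ b; the gates of an NP and a coNP certificate together therefore cover
-- every w ∈ \overline{Pol}(f•).
-- Conversely, given a Pol cover, guess one bit for r and for each column of each gate, and check
-- with O(N³) clauses over the N = n + 1 + 3|cover| bits that they respect equality, ∧, ∨ and ¬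
-- among the columns.  Any such assignment extends to a w ∈ B_{2ⁿ} covered by no gate, hence
-- w ∉ \overline{Pol}(f•) and f(x) ≡ w(r); and the x-th row of all the columns is a valid guess.

module Submission where

open import Defs
open import Data.Product using (_×_; Σ)
open import Function.Bundles using (_⇔_)
open import Data.Nat using (ℕ)

open import Data.Bool using (Bool; true; false; _∧_; _∨_; not; T) renaming (_≟_ to _≟ᵇ_)
open import Data.Bool.Properties using (T-∧; ¬-not)
open import Data.Empty using (⊥-elim)
open import Data.Fin using (Fin; zero; suc; _↑ˡ_; _↑ʳ_)
open import Data.List using (List; []; _∷_; length) renaming (map to mapₗ; _++_ to _++ₗ_)
open import Data.List.Properties using (length-++)
open import Data.List.Membership.Propositional using (_∈_; find; lose)
open import Data.List.Membership.Propositional.Properties using (∈-++⁺ˡ; ∈-++⁺ʳ)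
open import Data.List.Relation.Unary.Any using (here; there; any?)
open import Data.Nat using (zero; suc; _+_; _*_; _^_; _≤_; z≤n; s≤s)
open import Data.Nat.Properties
open import Data.Nat.Tactic.RingSolver using (solve-∀)
open import Data.Product using (_,_; proj₁; proj₂)
open import Data.Vec using (Vec; []; _∷_; lookup; _++_; map; zipWith; tabulate; replicate; concat; fromList)
open import Data.Vec.Properties
open import Data.Vec.Membership.Propositional using () renaming (_∈_ to _∈ᵥ_)
open import Data.Vec.Membership.Propositional.Properties
  using (∈-lookup; ∈-map⁺; ∈-fromList⁺) renaming (∈-++⁺ˡ to ∈ᵥ-++⁺ˡ; ∈-++⁺ʳ to ∈ᵥ-++⁺ʳ)
import Data.Vec.Relation.Unary.Any as Anyᵥ
open import Data.Vec.Relation.Unary.Any using (index) renaming (here to hereᵥ; there to thereᵥ)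
open import Data.Vec.Relation.Unary.Any.Properties using (lookup-index; concat⁺)
open import Data.Vec.Relation.Binary.Pointwise.Extensional using (ext; Pointwise-≡⇒≡)
open import Function using (_∘_)
open import Function.Bundles using (mk⇔; Equivalence)
open import Relation.Binary.PropositionalEquality
open import Relation.Nullary using (Dec; yes; no; ¬_)
open import Relation.Nullary.Decidable using (decidable-stable; ¬?)

-- Polynomial bounds

infixl 6 _⊕_
infixl 7 _⊛_

_⊕_ : Poly → Poly → Poly
[] ⊕ q = q
(a ∷ p) ⊕ [] = a ∷ p
(a ∷ p) ⊕ (b ∷ q) = a + b ∷ p ⊕ q

evalPoly-⊕ : ∀ p q n → evalPoly (p ⊕ q) n ≡ evalPoly p n + evalPoly q n
evalPoly-⊕ [] q n = refl
evalPoly-⊕ (a ∷ p) [] n = sym (+-identityʳ _)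
evalPoly-⊕ (a ∷ p) (b ∷ q) n =
  trans (cong (λ z → a + b + n * z) (evalPoly-⊕ p q n)) (regroup a b n (evalPoly p n) (evalPoly q n))
  where
  regroup : ∀ a b n x y → a + b + n * (x + y) ≡ a + n * x + (b + n * y)
  regroup = solve-∀

scale : ℕ → Poly → Poly
scale c = mapₗ (c *_)

evalPoly-scale : ∀ c p n → evalPoly (scale c p) n ≡ c * evalPoly p n
evalPoly-scale c [] n = sym (*-zeroʳ c)
evalPoly-scale c (a ∷ p) n =
  trans (cong (λ z → c * a + n * z) (evalPoly-scale c p n)) (distribute c a n (evalPoly p n))
  where
  distribute : ∀ c a n x → c * a + n * (c * x) ≡ c * (a + n * x)
  distribute = solve-∀

_⊛_ : Poly → Poly → Poly
[] ⊛ q = []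
(a ∷ p) ⊛ q = scale a q ⊕ (0 ∷ p ⊛ q)

evalPoly-⊛ : ∀ p q n → evalPoly (p ⊛ q) n ≡ evalPoly p n * evalPoly q n
evalPoly-⊛ [] q n = refl
evalPoly-⊛ (a ∷ p) q n = begin
  evalPoly (scale a q ⊕ (0 ∷ p ⊛ q)) n            ≡⟨ evalPoly-⊕ (scale a q) (0 ∷ p ⊛ q) n ⟩
  evalPoly (scale a q) n + n * evalPoly (p ⊛ q) n
    ≡⟨ cong₂ (λ u v → u + n * v) (evalPoly-scale a q n) (evalPoly-⊛ p q n) ⟩
  a * y + n * (evalPoly p n * y)                   ≡⟨ factor a n (evalPoly p n) y ⟩
  (a + n * evalPoly p n) * y                       ∎
  where
  open ≡-Reasoning
  y = evalPoly q n
  factor : ∀ a n x y → a * y + n * (x * y) ≡ (a + n * x) * y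
  factor = solve-∀

PolyBounded : (ℕ → ℕ) → Set
PolyBounded g = Σ Poly λ p → ∀ n → g n ≤ evalPoly p n

polyBounded-evalPoly : ∀ p → PolyBounded (evalPoly p)
polyBounded-evalPoly p = p , λ n → ≤-refl

polyBounded-const : ∀ c → PolyBounded (λ _ → c)
polyBounded-const c = c ∷ [] , λ n → m≤m+n c (n * 0)

polyBounded-id : PolyBounded (λ n → n)
polyBounded-id = 0 ∷ 1 ∷ [] , λ n → m≤m*n n (1 + n * 0)

polyBounded-+ : ∀ {f g} → PolyBounded f → PolyBounded g → PolyBounded (λ n → f n + g n)
polyBounded-+ (p , f≤p) (q , g≤q) =
  p ⊕ q , λ n → ≤-trans (+-mono-≤ (f≤p n) (g≤q n)) (≤-reflexive (sym (evalPoly-⊕ p q n)))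

polyBounded-* : ∀ {f g} → PolyBounded f → PolyBounded g → PolyBounded (λ n → f n * g n)
polyBounded-* (p , f≤p) (q , g≤q) =
  p ⊛ q , λ n → ≤-trans (*-mono-≤ (f≤p n) (g≤q n)) (≤-reflexive (sym (evalPoly-⊛ p q n)))

polyBounded⇒poly : (P : ℕ → ℕ → Set) → (∀ {n s s'} → s ≤ s' → P n s → P n s') →
  ∀ {g} → (∀ n → P n (g n)) → PolyBounded g → Σ Poly λ p → ∀ n → P n (evalPoly p n)
polyBounded⇒poly P mono h (p , g≤p) = p , λ n → mono (g≤p n) (h n)

-- Formulas and their compilation into circuits

data BinOp : Set where
  conj disj : BinOp

⟦_⟧ : BinOp → Bool → Bool → Bool
⟦ conj ⟧ = _∧_
⟦ disj ⟧ = _∨_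

binGate : ∀ {k} → BinOp → Fin k → Fin k → Gate k
binGate conj = andG
binGate disj = orG

evalGate-binGate : ∀ {k} o (i j : Fin k) v → evalGate (binGate o i j) v ≡ ⟦ o ⟧ (lookup v i) (lookup v j)
evalGate-binGate conj i j v = refl
evalGate-binGate disj i j v = refl

data Expr (K : ℕ) : Set where
  var : Fin K → Expr K
  bin : BinOp → Expr K → Expr K → Expr K
  neg : Expr K → Expr K

evalE : ∀ {K} → Expr K → (Fin K → Bool) → Bool
evalE (var i) env = env i
evalE (bin o a b) env = ⟦ o ⟧ (evalE a env) (evalE b env)
evalE (neg a) env = not (evalE a env)

cost : ∀ {K} → Expr K → ℕ
cost (var i) = 0
cost (bin o a b) = suc (cost a + cost b)
cost (neg a) = suc (cost a)

lift : ∀ {k k'} → (Fin k → Fin k') → Fin (suc k) → Fin (suc k')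
lift ρ zero = zero
lift ρ (suc i) = suc (ρ i)

renameGate : ∀ {k k'} → (Fin k → Fin k') → Gate k → Gate k'
renameGate ρ (andG i j) = andG (ρ i) (ρ j)
renameGate ρ (orG i j) = orG (ρ i) (ρ j)
renameGate ρ (notG i) = notG (ρ i)

rename : ∀ {k k'} → (Fin k → Fin k') → Circuit k → Circuit k'
rename ρ (out i) = out (ρ i)
rename ρ (g ▷ c) = renameGate ρ g ▷ rename (lift ρ) c

evalGate-rename : ∀ {k k'} (ρ : Fin k → Fin k') g {v v'} → (∀ i → lookup v' (ρ i) ≡ lookup v i) →
  evalGate (renameGate ρ g) v' ≡ evalGate g v
evalGate-rename ρ (andG i j) v≗ = cong₂ _∧_ (v≗ i) (v≗ j)
evalGate-rename ρ (orG i j) v≗ = cong₂ _∨_ (v≗ i) (v≗ j)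
evalGate-rename ρ (notG i) v≗ = cong not (v≗ i)

eval-rename : ∀ {k k'} (ρ : Fin k → Fin k') c {v v'} → (∀ i → lookup v' (ρ i) ≡ lookup v i) →
  eval (rename ρ c) v' ≡ eval c v
eval-rename ρ (out i) v≗ = v≗ i
eval-rename ρ (g ▷ c) {v} {v'} v≗ = eval-rename (lift ρ) c extended
  where
  extended : ∀ i → lookup (evalGate (renameGate ρ g) v' ∷ v') (lift ρ i) ≡ lookup (evalGate g v ∷ v) i
  extended zero = evalGate-rename ρ g v≗
  extended (suc i) = v≗ i

size-rename : ∀ {k k'} (ρ : Fin k → Fin k') c → size (rename ρ c) ≡ size c
size-rename ρ (out i) = refl
size-rename ρ (g ▷ c) = cong suc (size-rename (lift ρ) c)

collapse : ∀ {k} → Fin k → Fin (suc k) → Fin k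
collapse i zero = i
collapse i (suc j) = j

-- A variable costs no gate: the continuation is rewired to read it directly.
comp : ∀ {K k} → Expr K → (Fin K → Fin k) → Circuit (suc k) → Circuit k
comp (var i) σ c = rename (collapse (σ i)) c
comp (neg e) σ c = comp e σ (notG zero ▷ rename (lift suc) c)
comp (bin o e₁ e₂) σ c =
  comp e₁ σ (comp e₂ (λ i → suc (σ i)) (binGate o (suc zero) zero ▷ rename (lift (λ i → suc (suc i))) c))

eval-comp : ∀ {K k} e (σ : Fin K → Fin k) c v → eval (comp e σ c) v ≡ eval c (evalE e (lookup v ∘ σ) ∷ v)
eval-comp (var i) σ c v = eval-rename (collapse (σ i)) c λ { zero → refl ; (suc j) → refl }
eval-comp (neg e) σ c v =
  trans (eval-comp e σ _ v) (eval-rename (lift suc) c λ { zero → refl ; (suc j) → refl })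
eval-comp (bin o e₁ e₂) σ c v =
  trans (eval-comp e₁ σ _ v) (trans (eval-comp e₂ (λ i → suc (σ i)) _ (a ∷ v))
    (eval-rename (lift (λ i → suc (suc i))) c
      λ { zero → evalGate-binGate o (suc zero) zero (b ∷ a ∷ v) ; (suc j) → refl }))
  where
  a = evalE e₁ (lookup v ∘ σ)
  b = evalE e₂ (lookup v ∘ σ)

size-comp : ∀ {K k} e (σ : Fin K → Fin k) c → size (comp e σ c) ≡ cost e + size c
size-comp (var i) σ c = size-rename (collapse (σ i)) c
size-comp (neg e) σ c = begin
  size (comp e σ _)                      ≡⟨ size-comp e σ _ ⟩
  cost e + suc (size (rename (lift suc) c)) ≡⟨ cong (λ s → cost e + suc s) (size-rename (lift suc) c) ⟩
  cost e + suc (size c)                  ≡⟨ +-suc (cost e) (size c) ⟩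
  suc (cost e + size c)                  ∎
  where open ≡-Reasoning
size-comp (bin o e₁ e₂) σ c = begin
  size (comp e₁ σ _)                             ≡⟨ size-comp e₁ σ _ ⟩
  cost e₁ + size (comp e₂ (λ i → suc (σ i)) _)   ≡⟨ cong (cost e₁ +_) (size-comp e₂ _ _) ⟩
  cost e₁ + (cost e₂ + suc (size (rename _ c)))  ≡⟨ cong (λ s → cost e₁ + (cost e₂ + suc s)) (size-rename _ c) ⟩
  cost e₁ + (cost e₂ + suc (size c))             ≡⟨ regroup (cost e₁) (cost e₂) (size c) ⟩
  suc (cost e₁ + cost e₂ + size c)               ∎
  where
  open ≡-Reasoning
  regroup : ∀ x y s → x + (y + suc s) ≡ suc (x + y + s)
  regroup = solve-∀

compile : ∀ {K} → Expr K → Circuit K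
compile e = comp e (λ i → i) (out zero)

eval-compile : ∀ {K} (e : Expr K) v → eval (compile e) v ≡ evalE e (lookup v)
eval-compile e v = eval-comp e (λ i → i) (out zero) v

size-compile : ∀ {K} (e : Expr K) → size (compile e) ≡ cost e
size-compile e = trans (size-comp e (λ i → i) (out zero)) (+-identityʳ (cost e))

infix 4 _⊨_
infix 5 _⇔ᴱ_
infixr 6 _∨ᴱ_
infixr 7 _∧ᴱ_

_⊨_ : ∀ {K} → (Fin K → Bool) → Expr K → Set
env ⊨ e = T (evalE e env)

_∧ᴱ_ _∨ᴱ_ _⇔ᴱ_ : ∀ {K} → Expr K → Expr K → Expr K
a ∧ᴱ b = bin conj a b
a ∨ᴱ b = bin disj a b
a ⇔ᴱ b = (a ∧ᴱ b) ∨ᴱ (neg a ∧ᴱ neg b)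

⊨-∧ᴱ : ∀ {K} (env : Fin K → Bool) a b → env ⊨ a ∧ᴱ b ⇔ (env ⊨ a × env ⊨ b)
⊨-∧ᴱ env a b = T-∧

⊨-⇔ᴱ : ∀ {K} (env : Fin K → Bool) a b → env ⊨ a ⇔ᴱ b ⇔ (evalE a env ≡ evalE b env)
⊨-⇔ᴱ env a b with evalE a env | evalE b env
... | false | false = mk⇔ (λ _ → refl) _
... | false | true = mk⇔ (λ ()) (λ ())
... | true | false = mk⇔ (λ ()) (λ ())
... | true | true = mk⇔ (λ _ → refl) _

taut : ∀ {K} → Fin K → Expr K
taut i = var i ∨ᴱ neg (var i)

⊨-taut : ∀ {K} (env : Fin K → Bool) i → env ⊨ taut i
⊨-taut env i with env i
... | false = _
... | true = _

-- Expr has no constants, so the trivially true branch is a tautology over a supplied variable.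
equalIf : ∀ {K} {P : Set} → Dec P → Fin K → Expr K → Expr K → Expr K
equalIf (yes _) i a b = a ⇔ᴱ b
equalIf (no _) i a b = taut i

⊨-equalIf : ∀ {K} {P : Set} (d : Dec P) env (i : Fin K) a b →
  env ⊨ equalIf d i a b ⇔ (P → evalE a env ≡ evalE b env)
⊨-equalIf (yes p) env i a b =
  mk⇔ (λ h _ → Equivalence.to (⊨-⇔ᴱ env a b) h) (λ h → Equivalence.from (⊨-⇔ᴱ env a b) (h p))
⊨-equalIf (no ¬p) env i a b = mk⇔ (λ _ p → ⊥-elim (¬p p)) (λ _ → ⊨-taut env i)

cost-equalIf : ∀ {K} {P : Set} (d : Dec P) (i : Fin K) a b → cost (equalIf d i a b) ≤ cost (a ⇔ᴱ b)
cost-equalIf (yes _) i a b = ≤-refl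
cost-equalIf (no _) i a b = s≤s (s≤s z≤n)

⋀ : ∀ {K} (M : ℕ) → (Fin M → Expr K) → Expr K → Expr K
⋀ zero f b = b
⋀ (suc M) f b = f zero ∧ᴱ ⋀ M (f ∘ suc) b

⊨-⋀ : ∀ {K} (env : Fin K → Bool) M f b → env ⊨ ⋀ M f b ⇔ ((∀ a → env ⊨ f a) × env ⊨ b)
⊨-⋀ env zero f b = mk⇔ (λ h → (λ ()) , h) proj₂
⊨-⋀ env (suc M) f b = mk⇔ split join
  where
  step = ⊨-∧ᴱ env (f zero) (⋀ M (f ∘ suc) b)
  ih = ⊨-⋀ env M (f ∘ suc) b
  split : env ⊨ ⋀ (suc M) f b → (∀ a → env ⊨ f a) × env ⊨ b
  split h with Equivalence.to step h
  ... | h₀ , hs with Equivalence.to ih hs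
  ...   | all , hb = (λ { zero → h₀ ; (suc a) → all a }) , hb
  join : (∀ a → env ⊨ f a) × env ⊨ b → env ⊨ ⋀ (suc M) f b
  join (all , hb) = Equivalence.from step (all zero , Equivalence.from ih ((all ∘ suc) , hb))

cost-⋀ : ∀ {K} M (f : Fin M → Expr K) b {c} →
  (∀ a → cost (f a) ≤ c) → cost (⋀ M f b) ≤ M * suc c + cost b
cost-⋀ zero f b f≤c = ≤-refl
cost-⋀ (suc M) f b {c} f≤c = s≤s (begin
  cost (f zero) + cost (⋀ M (f ∘ suc) b) ≤⟨ +-mono-≤ (f≤c zero) (cost-⋀ M (f ∘ suc) b (f≤c ∘ suc)) ⟩
  c + (M * suc c + cost b)                ≡⟨ +-assoc c (M * suc c) (cost b) ⟨
  c + M * suc c + cost b                  ∎)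
  where open ≤-Reasoning

polarity : ∀ {K} → Bool → Expr K → Expr K
polarity true e = e
polarity false e = neg e

evalE-polarity : ∀ {K} b (e : Expr K) env → evalE (polarity b e) env ≡ b ⇔ env ⊨ e
evalE-polarity true e env with evalE e env
... | true = mk⇔ _ (λ _ → refl)
... | false = mk⇔ (λ ()) (λ ())
evalE-polarity false e env with evalE e env
... | true = mk⇔ _ (λ _ → refl)
... | false = mk⇔ (λ ()) (λ ())

⊨-polarity-var : ∀ {K} b (i : Fin K) env → env ⊨ polarity b (var i) ⇔ env i ≡ b
⊨-polarity-var true i env with env i
... | true = mk⇔ (λ _ → refl) _
... | false = mk⇔ (λ ()) (λ ())
⊨-polarity-var false i env with env i
... | true = mk⇔ (λ ()) (λ ())
... | false = mk⇔ (λ _ → refl) _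

cost-polarity : ∀ {K} b (e : Expr K) → cost (polarity b e) ≤ suc (cost e)
cost-polarity true e = n≤1+n (cost e)
cost-polarity false e = ≤-refl

-- Running a circuit on columns

¬≢⇒≡ : ∀ {a b : Bool} → ¬ (a ≢ b) → a ≡ b
¬≢⇒≡ {a} {b} = decidable-stable (a ≟ᵇ b)

rowAt : ∀ {m k} → Fin m → Vec (Vec Bool m) k → Vec Bool k
rowAt ρ = map (λ u → lookup u ρ)

module _ {n : ℕ} where

  colGate : ∀ {k} → Gate k → Vec (Column n) k → ColGate n
  colGate (andG i j) V = andC (lookup V i) (lookup V j)
  colGate (orG i j) V = orC (lookup V i) (lookup V j)
  colGate (notG i) V = notC (lookup V i)

  output : ColGate n → Column n
  output (andC u v) = zipWith _∧_ u v
  output (orC u v) = zipWith _∨_ u v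
  output (notC u) = map not u

  columnGates : ∀ {k} → Circuit k → Vec (Column n) k → List (ColGate n)
  columnGates (out i) V = []
  columnGates (g ▷ c) V = colGate g V ∷ columnGates c (output (colGate g V) ∷ V)

  columnOutput : ∀ {k} → Circuit k → Vec (Column n) k → Column n
  columnOutput (out i) V = lookup V i
  columnOutput (g ▷ c) V = columnOutput c (output (colGate g V) ∷ V)

  length-columnGates : ∀ {k} (c : Circuit k) (V : Vec (Column n) k) → length (columnGates c V) ≡ size c
  length-columnGates (out i) V = refl
  length-columnGates (g ▷ c) V = cong suc (length-columnGates c _)

  output-uncovered : ∀ {k} (g : Gate k) (V : Vec (Column n) k) w →
    ¬ Covers (colGate g V) w → w (output (colGate g V)) ≡ evalGate g (map w V)
  output-uncovered (andG i j) V w ¬cov =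
    trans (¬≢⇒≡ ¬cov) (sym (cong₂ _∧_ (lookup-map i w V) (lookup-map j w V)))
  output-uncovered (orG i j) V w ¬cov =
    trans (¬≢⇒≡ ¬cov) (sym (cong₂ _∨_ (lookup-map i w V) (lookup-map j w V)))
  output-uncovered (notG i) V w ¬cov =
    trans (¬≢⇒≡ ¬cov) (sym (cong not (lookup-map i w V)))

  columnOutput-uncovered : ∀ {k} (c : Circuit k) (V : Vec (Column n) k) w →
    (∀ g → g ∈ columnGates c V → ¬ Covers g w) → w (columnOutput c V) ≡ eval c (map w V)
  columnOutput-uncovered (out i) V w unc = sym (lookup-map i w V)
  columnOutput-uncovered (g ▷ c) V w unc = begin
    w (columnOutput c (output (colGate g V) ∷ V))  ≡⟨ columnOutput-uncovered c _ w (λ h h∈ → unc h (there h∈)) ⟩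
    eval c (w (output (colGate g V)) ∷ map w V)
      ≡⟨ cong (λ z → eval c (z ∷ map w V)) (output-uncovered g V w (unc _ (here refl))) ⟩
    eval c (evalGate g (map w V) ∷ map w V)        ∎
    where open ≡-Reasoning

  rowProjection-uncovered : (g : ColGate n) (ρ : Fin (2 ^ n)) → ¬ Covers g (λ u → lookup u ρ)
  rowProjection-uncovered (andC u v) ρ cov = cov (lookup-zipWith _∧_ ρ u v)
  rowProjection-uncovered (orC u v) ρ cov = cov (lookup-zipWith _∨_ ρ u v)
  rowProjection-uncovered (notC u) ρ cov = cov (lookup-map ρ not u)

  lookup-columnOutput : ∀ {k} (c : Circuit k) (V : Vec (Column n) k) ρ →
    lookup (columnOutput c V) ρ ≡ eval c (rowAt ρ V)
  lookup-columnOutput c V ρ = columnOutput-uncovered c V (λ u → lookup u ρ) (λ g _ → rowProjection-uncovered g ρ)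

  -- Certificate circuits yield Pol covers

  Certifies : ∀ {k} → Bool → (Vec Bool n → Bool) → Circuit (n + k) → Set
  Certifies {k} b f C = (x : Vec Bool n) → (f x ≡ b) ⇔ (Σ (Vec Bool k) λ y → eval C (x ++ y) ≡ b)

  Certifier : Bool → (Vec Bool n → Bool) → ℕ → Set
  Certifier b f s = Σ ℕ λ k → Σ (Circuit (n + k)) λ C → (size C + k ≤ s) × Certifies b f C

  Certifier-mono : ∀ {b} {f : Vec Bool n → Bool} {s s'} → s ≤ s' → Certifier b f s → Certifier b f s'
  Certifier-mono s≤s' (k , C , bound , cert) = k , C , ≤-trans bound s≤s' , cert

  TSize≤-mono : ∀ {f : Vec Bool n → Bool} {s s'} → s ≤ s' → TSize≤ n f s → TSize≤ n f s'
  TSize≤-mono s≤s' (gs , cover , bound) = gs , cover , ≤-trans bound s≤s'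

  columnsOf : ∀ {k} → (Vec Bool n → Vec Bool k) → Vec (Column n) k
  columnsOf g = tabulate λ j → map (λ a → lookup (g a) j) (rows n)

  rowAt-columnsOf : ∀ {k} (g : Vec Bool n → Vec Bool k) ρ → rowAt ρ (columnsOf g) ≡ g (lookup (rows n) ρ)
  rowAt-columnsOf g ρ = begin
    map (λ u → lookup u ρ) (tabulate λ j → map (λ a → lookup (g a) j) (rows n))  ≡⟨ tabulate-∘ _ _ ⟨
    tabulate (λ j → lookup (map (λ a → lookup (g a) j) (rows n)) ρ)
      ≡⟨ tabulate-cong (λ j → lookup-map ρ _ (rows n)) ⟩
    tabulate (lookup (g (lookup (rows n) ρ)))                                  ≡⟨ tabulate∘lookup _ ⟩
    g (lookup (rows n) ρ)                                                      ∎
    where open ≡-Reasoning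

  module Certificate {k} {b} {f : Vec Bool n → Bool} {C : Circuit (n + k)} (cert : Certifies b f C) where

    witness : ∀ x → Σ (Vec Bool k) λ y → eval C (x ++ y) ≡ f x
    witness x with f x ≟ᵇ b
    ... | yes fx≡b = let y , e = Equivalence.to (cert x) fx≡b in y , trans e (sym fx≡b)
    ... | no fx≢b = y , trans (¬-not C≢b) (sym (¬-not fx≢b))
      where
      y = replicate k false
      C≢b : eval C (x ++ y) ≢ b
      C≢b e = fx≢b (Equivalence.from (cert x) (y , e))

    witnessColumns : Vec (Column n) k
    witnessColumns = columnsOf (proj₁ ∘ witness)

    columns : Vec (Column n) (n + k)
    columns = tabulate (xCol n) ++ witnessColumns

    gates : List (ColGate n)
    gates = columnGates C columns

    columnOutput-columns : columnOutput C columns ≡ rCol n f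
    columnOutput-columns = Pointwise-≡⇒≡ (ext λ ρ → let a = lookup (rows n) ρ in begin
      lookup (columnOutput C columns) ρ        ≡⟨ lookup-columnOutput C columns ρ ⟩
      eval C (rowAt ρ columns)                 ≡⟨ cong (eval C) (map-++ _ (tabulate (xCol n)) witnessColumns) ⟩
      eval C (rowAt ρ (tabulate (xCol n)) ++ rowAt ρ witnessColumns)
        ≡⟨ cong₂ (λ x y → eval C (x ++ y)) (rowAt-columnsOf (λ a → a) ρ)
                                            (rowAt-columnsOf (proj₁ ∘ witness) ρ) ⟩
      eval C (a ++ proj₁ (witness a))          ≡⟨ proj₂ (witness a) ⟩
      f a                                      ≡⟨ lookup-map ρ f (rows n) ⟨
      lookup (rCol n f) ρ                      ∎)
      where open ≡-Reasoning

    uncovered-sound : ∀ w → (∀ g → g ∈ gates → ¬ Covers g w) →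
      w (rCol n f) ≡ b → f (tabulate (w ∘ xCol n)) ≡ b
    uncovered-sound w unc wr≡b = Equivalence.from (cert _) (map w witnessColumns , (begin
      eval C (tabulate (w ∘ xCol n) ++ map w witnessColumns)
        ≡⟨ cong (λ x → eval C (x ++ map w witnessColumns)) (tabulate-∘ w (xCol n)) ⟩
      eval C (map w (tabulate (xCol n)) ++ map w witnessColumns)
        ≡⟨ cong (eval C) (map-++ w (tabulate (xCol n)) witnessColumns) ⟨
      eval C (map w columns)      ≡⟨ columnOutput-uncovered C columns w unc ⟨
      w (columnOutput C columns)  ≡⟨ cong w columnOutput-columns ⟩
      w (rCol n f)                ≡⟨ wr≡b ⟩
      b                           ∎))
      where open ≡-Reasoning

  covers? : (g : ColGate n) (w : B (2 ^ n)) → Dec (Covers g w)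
  covers? (andC u v) w = ¬? (w (zipWith _∧_ u v) ≟ᵇ (w u ∧ w v))
  covers? (orC u v) w = ¬? (w (zipWith _∨_ u v) ≟ᵇ (w u ∨ w v))
  covers? (notC u) w = ¬? (w (map not u) ≟ᵇ not (w u))

  isPolCover-fromUncovered : ∀ {f : Vec Bool n → Bool} gs →
    (∀ w → (∀ g → g ∈ gs → ¬ Covers g w) → ¬ InPolBar n f w) → IsPolCover n f gs
  isPolCover-fromUncovered gs unc⇒pol w bar with any? (λ g → covers? g w) gs
  ... | yes covered = find covered
  ... | no ¬covered = ⊥-elim (unc⇒pol w (λ g g∈gs cov → ¬covered (lose g∈gs cov)) bar)

  certifiers⇒cover : ∀ {f : Vec Bool n → Bool} {s s'} →
    Certifier true f s → Certifier false f s' → TSize≤ n f (s + s')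
  certifiers⇒cover {f} {s} {s'} (k , C , bound , cert) (k' , C' , bound' , cert') =
    gates₁ ++ₗ gates₂ , isPolCover-fromUncovered (gates₁ ++ₗ gates₂) unc⇒pol , length-bound
    where
    open Certificate {C = C} cert renaming (gates to gates₁; uncovered-sound to sound₁)
    open Certificate {C = C'} cert' renaming (gates to gates₂; uncovered-sound to sound₂)
    unc⇒pol : ∀ w → (∀ g → g ∈ gates₁ ++ₗ gates₂ → ¬ Covers g w) → ¬ InPolBar n f w
    unc⇒pol w unc bar with w (rCol n f) in wr
    ... | true = bar (sym (sound₁ w (λ g → unc g ∘ ∈-++⁺ˡ) wr))
    ... | false = bar (sym (sound₂ w (λ g → unc g ∘ ∈-++⁺ʳ gates₁) wr))
    length-bound : length (gates₁ ++ₗ gates₂) ≤ s + s'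
    length-bound = begin
      length (gates₁ ++ₗ gates₂)          ≡⟨ length-++ gates₁ ⟩
      length gates₁ + length gates₂      ≡⟨ cong₂ _+_ (length-columnGates C _) (length-columnGates C' _) ⟩
      size C + size C'
        ≤⟨ +-mono-≤ (≤-trans (m≤m+n (size C) k) bound) (≤-trans (m≤m+n (size C') k') bound') ⟩
      s + s'                             ∎
      where open ≤-Reasoning

-- Partial polymorphisms of a finite family of columns

-- Three nested ⋀ of N conjuncts, around constraints of cost ≤ 29 and tautologies of cost 2.
consistencyCost : ℕ → ℕ
consistencyCost N = N * suc (N * suc (N * 30 + 2) + 2)

consistencyCost-mono : ∀ {M M'} → M ≤ M' → consistencyCost M ≤ consistencyCost M'
consistencyCost-mono p = *-mono-≤ p (s≤s (+-monoˡ-≤ 2 (*-mono-≤ p (s≤s (+-monoˡ-≤ 2 (*-mono-≤ p ≤-refl))))))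

module PartialPolymorphism {m N : ℕ} (cols : Vec (Vec Bool m) N) where

  -- Indexed by triples so that one ⋀ over i, j, l checks everything; pres-≡ and pres-¬ ignore l.
  record Preserves (vals : Vec Bool N) (i j l : Fin N) : Set where
    field
      pres-≡ : lookup cols i ≡ lookup cols j → lookup vals i ≡ lookup vals j
      pres-∧ : lookup cols l ≡ zipWith _∧_ (lookup cols i) (lookup cols j) →
               lookup vals l ≡ lookup vals i ∧ lookup vals j
      pres-∨ : lookup cols l ≡ zipWith _∨_ (lookup cols i) (lookup cols j) →
               lookup vals l ≡ lookup vals i ∨ lookup vals j
      pres-¬ : lookup cols j ≡ map not (lookup cols i) → lookup vals j ≡ not (lookup vals i)

  open Preserves public

  IsPartialPol : Vec Bool N → Set
  IsPartialPol vals = ∀ i j l → Preserves vals i j l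

  row-isPartialPol : ∀ ρ → IsPartialPol (rowAt ρ cols)
  row-isPartialPol ρ i j l = record
    { pres-≡ = λ p → trans (at i) (trans (cong (λ u → lookup u ρ) p) (sym (at j)))
    ; pres-∧ = λ p → trans (at l) (trans (cong (λ u → lookup u ρ) p)
        (trans (lookup-zipWith _∧_ ρ (lookup cols i) (lookup cols j)) (sym (cong₂ _∧_ (at i) (at j)))))
    ; pres-∨ = λ p → trans (at l) (trans (cong (λ u → lookup u ρ) p)
        (trans (lookup-zipWith _∨_ ρ (lookup cols i) (lookup cols j)) (sym (cong₂ _∨_ (at i) (at j)))))
    ; pres-¬ = λ p → trans (at j) (trans (cong (λ u → lookup u ρ) p)
        (trans (lookup-map ρ not (lookup cols i)) (sym (cong not (at i)))))
    }
    where
    at : ∀ i → lookup (rowAt ρ cols) i ≡ lookup (lookup cols i) ρ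
    at i = lookup-map i (λ u → lookup u ρ) cols

  _≟ᶜ_ : (u v : Vec Bool m) → Dec (u ≡ v)
  _≟ᶜ_ = ≡-dec _≟ᵇ_

  open import Data.Vec.Membership.DecPropositional _≟ᶜ_ using () renaming (_∈?_ to _∈ᵥ?_)

  ≡-check ¬-check : Fin N → Fin N → Expr N
  ≡-check i j = equalIf (lookup cols i ≟ᶜ lookup cols j) i (var i) (var j)
  ¬-check i j = equalIf (lookup cols j ≟ᶜ map not (lookup cols i)) i (var j) (neg (var i))

  ∧-check ∨-check : Fin N → Fin N → Fin N → Expr N
  ∧-check i j l = equalIf (lookup cols l ≟ᶜ zipWith _∧_ (lookup cols i) (lookup cols j)) i (var l) (var i ∧ᴱ var j)
  ∨-check i j l = equalIf (lookup cols l ≟ᶜ zipWith _∨_ (lookup cols i) (lookup cols j)) i (var l) (var i ∨ᴱ var j)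

  constraint : Fin N → Fin N → Fin N → Expr N
  constraint i j l = ≡-check i j ∧ᴱ ∧-check i j l ∧ᴱ ∨-check i j l ∧ᴱ ¬-check i j

  ⊨-constraint : ∀ vals i j l → lookup vals ⊨ constraint i j l ⇔ Preserves vals i j l
  ⊨-constraint vals i j l = mk⇔ sound complete
    where
    open Equivalence
    env = lookup vals
    ⊨≡ = ⊨-equalIf (lookup cols i ≟ᶜ _) env i (var i) (var j)
    ⊨∧ = ⊨-equalIf (lookup cols l ≟ᶜ _) env i (var l) (var i ∧ᴱ var j)
    ⊨∨ = ⊨-equalIf (lookup cols l ≟ᶜ _) env i (var l) (var i ∨ᴱ var j)
    ⊨¬ = ⊨-equalIf (lookup cols j ≟ᶜ _) env i (var j) (neg (var i))
    split₁ = ⊨-∧ᴱ env (≡-check i j) (∧-check i j l ∧ᴱ ∨-check i j l ∧ᴱ ¬-check i j)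
    split₂ = ⊨-∧ᴱ env (∧-check i j l) (∨-check i j l ∧ᴱ ¬-check i j)
    split₃ = ⊨-∧ᴱ env (∨-check i j l) (¬-check i j)
    sound : env ⊨ constraint i j l → Preserves vals i j l
    sound h with to split₁ h
    ... | h≡ , h′ with to split₂ h′
    ... | h∧ , h″ with to split₃ h″
    ... | h∨ , h¬ = record { pres-≡ = to ⊨≡ h≡ ; pres-∧ = to ⊨∧ h∧ ; pres-∨ = to ⊨∨ h∨ ; pres-¬ = to ⊨¬ h¬ }
    complete : Preserves vals i j l → env ⊨ constraint i j l
    complete p = from split₁ (from ⊨≡ (pres-≡ p) ,
                 from split₂ (from ⊨∧ (pres-∧ p) ,
                 from split₃ (from ⊨∨ (pres-∨ p) , from ⊨¬ (pres-¬ p))))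

  cost-constraint : ∀ i j l → cost (constraint i j l) ≤ 29
  cost-constraint i j l =
    s≤s (+-mono-≤ (cost-equalIf (lookup cols i ≟ᶜ _) i _ _)
      (s≤s (+-mono-≤ (cost-equalIf (lookup cols l ≟ᶜ _) i _ _)
        (s≤s (+-mono-≤ (cost-equalIf (lookup cols l ≟ᶜ _) i _ _) (cost-equalIf (lookup cols j ≟ᶜ _) i _ _))))))

  consistentAnd : Expr N → Expr N
  consistentAnd base = ⋀ N (λ i → ⋀ N (λ j → ⋀ N (constraint i j) (taut i)) (taut i)) base

  ⊨-consistentAnd : ∀ vals base →
    lookup vals ⊨ consistentAnd base ⇔ (IsPartialPol vals × lookup vals ⊨ base)
  ⊨-consistentAnd vals base = mk⇔
    (λ h → let all-i , hb = to ⊨-outer h in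
      (λ i j l → to (⊨-constraint vals i j l)
        (proj₁ (to (⊨-inner i j) (proj₁ (to (⊨-middle i) (all-i i)) j)) l)) , hb)
    (λ (pp , hb) → from ⊨-outer
      ( (λ i → from (⊨-middle i)
          ( (λ j → from (⊨-inner i j) ((λ l → from (⊨-constraint vals i j l) (pp i j l)) , ⊨-taut env i))
          , ⊨-taut env i))
      , hb))
    where
    open Equivalence
    env = lookup vals
    ⊨-inner = λ i j → ⊨-⋀ env N (constraint i j) (taut i)
    ⊨-middle = λ i → ⊨-⋀ env N (λ j → ⋀ N (constraint i j) (taut i)) (taut i)
    ⊨-outer = ⊨-⋀ env N (λ i → ⋀ N (λ j → ⋀ N (constraint i j) (taut i)) (taut i)) base

  cost-consistentAnd : ∀ base → cost (consistentAnd base) ≤ consistencyCost N + cost base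
  cost-consistentAnd base =
    cost-⋀ N _ base λ i → cost-⋀ N _ (taut i) λ j → cost-⋀ N _ (taut i) (cost-constraint i j)

  extend : Vec Bool N → Vec Bool m → Bool
  extend vals u with u ∈ᵥ? cols
  ... | yes u∈cols = lookup vals (index u∈cols)
  ... | no _ = false

  extend-lookup : ∀ {vals} → IsPartialPol vals → ∀ {i u} → lookup cols i ≡ u → extend vals u ≡ lookup vals i
  extend-lookup pp {i} refl with lookup cols i ∈ᵥ? cols
  ... | yes u∈cols = pres-≡ (pp (index u∈cols) i i) (sym (lookup-index u∈cols))
  ... | no u∉cols = ⊥-elim (u∉cols (∈-lookup i cols))

  position : ∀ {u} (u∈ : u ∈ᵥ cols) → lookup cols (index u∈) ≡ u
  position u∈ = sym (lookup-index u∈)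

  extend-∈ : ∀ {vals} → IsPartialPol vals → ∀ {u} (u∈ : u ∈ᵥ cols) → extend vals u ≡ lookup vals (index u∈)
  extend-∈ pp u∈ = extend-lookup pp (position u∈)

-- Pol covers yield certificate formulas

gateColumns : ∀ {n} → ColGate n → Vec (Column n) 3
gateColumns (andC u v) = u ∷ v ∷ zipWith _∧_ u v ∷ []
gateColumns (orC u v) = u ∷ v ∷ zipWith _∨_ u v ∷ []
gateColumns (notC u) = u ∷ map not u ∷ u ∷ []  -- padded, so every gate adds three guessed bits

module _ {n N} (cols : Vec (Column n) N) where
  open PartialPolymorphism cols

  extend-uncovered : ∀ {vals} → IsPartialPol vals → (g : ColGate n) →
    (∀ {u} → u ∈ᵥ gateColumns g → u ∈ᵥ cols) → ¬ Covers g (extend vals)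
  extend-uncovered {vals} pp (andC u v) occurs covered = covered (begin
    extend vals (zipWith _∧_ u v)                    ≡⟨ extend-∈ pp z∈ ⟩
    lookup vals (index z∈)                           ≡⟨ pres-∧ (pp _ _ _) z≡u∧v ⟩
    lookup vals (index u∈) ∧ lookup vals (index v∈)  ≡⟨ cong₂ _∧_ (extend-∈ pp u∈) (extend-∈ pp v∈) ⟨
    extend vals u ∧ extend vals v                    ∎)
    where
    open ≡-Reasoning
    u∈ = occurs (hereᵥ refl)
    v∈ = occurs (thereᵥ (hereᵥ refl))
    z∈ = occurs (thereᵥ (thereᵥ (hereᵥ refl)))
    z≡u∧v = trans (position z∈) (sym (cong₂ (zipWith _∧_) (position u∈) (position v∈)))
  extend-uncovered {vals} pp (orC u v) occurs covered = covered (begin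
    extend vals (zipWith _∨_ u v)                    ≡⟨ extend-∈ pp z∈ ⟩
    lookup vals (index z∈)                           ≡⟨ pres-∨ (pp _ _ _) z≡u∨v ⟩
    lookup vals (index u∈) ∨ lookup vals (index v∈)  ≡⟨ cong₂ _∨_ (extend-∈ pp u∈) (extend-∈ pp v∈) ⟨
    extend vals u ∨ extend vals v                    ∎)
    where
    open ≡-Reasoning
    u∈ = occurs (hereᵥ refl)
    v∈ = occurs (thereᵥ (hereᵥ refl))
    z∈ = occurs (thereᵥ (thereᵥ (hereᵥ refl)))
    z≡u∨v = trans (position z∈) (sym (cong₂ (zipWith _∨_) (position u∈) (position v∈)))
  extend-uncovered {vals} pp (notC u) occurs covered = covered (begin
    extend vals (map not u)        ≡⟨ extend-∈ pp z∈ ⟩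
    lookup vals (index z∈)         ≡⟨ pres-¬ (pp (index u∈) (index z∈) (index z∈)) z≡¬u ⟩
    not (lookup vals (index u∈))   ≡⟨ cong not (extend-∈ pp u∈) ⟨
    not (extend vals u)            ∎)
    where
    open ≡-Reasoning
    u∈ = occurs (hereᵥ refl)
    z∈ = occurs (thereᵥ (hereᵥ refl))
    z≡¬u = trans (position z∈) (sym (cong (map not) (position u∈)))

∈-rows : ∀ {n} (x : Vec Bool n) → x ∈ᵥ rows n
∈-rows [] = hereᵥ refl
∈-rows (false ∷ x) = ∈ᵥ-++⁺ˡ (∈-map⁺ (false ∷_) (∈-rows x))
∈-rows {suc n} (true ∷ x) = ∈ᵥ-++⁺ʳ (map (false ∷_) (rows n)) (∈ᵥ-++⁺ˡ (∈-map⁺ (true ∷_) (∈-rows x)))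

formula⇒certifies : ∀ {n k b} {f : Vec Bool n → Bool} (F : Expr (n + k)) →
  (∀ x → (f x ≡ b) ⇔ (Σ (Vec Bool k) λ y → lookup (x ++ y) ⊨ F)) → Certifies b f (compile (polarity b F))
formula⇒certifies {b = b} F spec x = mk⇔
  (λ fx≡b → let y , h = to (spec x) fx≡b in
    y , trans (eval-compile (polarity b F) (x ++ y)) (from (evalE-polarity b F _) h))
  (λ (y , e) → from (spec x) (y , to (evalE-polarity b F _) (trans (sym (eval-compile (polarity b F) (x ++ y))) e)))
  where open Equivalence

certifierSize : ℕ → ℕ
certifierSize N = suc (consistencyCost N + 1) + N

certifierSize-mono : ∀ {M M'} → M ≤ M' → certifierSize M ≤ certifierSize M'
certifierSize-mono p = +-mono-≤ (s≤s (+-monoˡ-≤ 1 (consistencyCost-mono p))) p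

polyBounded-certifierSize : ∀ {g} → PolyBounded g → PolyBounded (λ n → certifierSize (g n))
polyBounded-certifierSize {g} G =
  polyBounded-+ (polyBounded-+ (polyBounded-const 1) (polyBounded-+ consistency (polyBounded-const 1))) G
  where
  plus2 : ∀ {h} → PolyBounded h → PolyBounded (λ n → h n + 2)
  plus2 H = polyBounded-+ H (polyBounded-const 2)
  times-suc : ∀ {h} → PolyBounded h → PolyBounded (λ n → g n * suc (h n))
  times-suc H = polyBounded-* G (polyBounded-+ (polyBounded-const 1) H)
  consistency = times-suc (plus2 (times-suc (plus2 (polyBounded-* G (polyBounded-const 30)))))

module PolCoverCertificate {n} {f : Vec Bool n → Bool} {gs} (cover : IsPolCover n f gs) where

  k : ℕ
  k = suc (length gs * 3)

  guessedColumns : Vec (Column n) k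
  guessedColumns = rCol n f ∷ concat (map gateColumns (fromList gs))

  columns : Vec (Column n) (n + k)
  columns = tabulate (xCol n) ++ guessedColumns

  open PartialPolymorphism columns

  r : Fin (n + k)
  r = n ↑ʳ zero

  lookup-r : lookup columns r ≡ rCol n f
  lookup-r = lookup-++ʳ (tabulate (xCol n)) guessedColumns zero

  lookup-x : ∀ i → lookup columns (i ↑ˡ k) ≡ xCol n i
  lookup-x i = trans (lookup-++ˡ (tabulate (xCol n)) guessedColumns i) (lookup∘tabulate (xCol n) i)

  gateColumns-∈ : ∀ {g u} → g ∈ gs → u ∈ᵥ gateColumns g → u ∈ᵥ columns
  gateColumns-∈ {g} {u} g∈gs u∈g = ∈ᵥ-++⁺ʳ (tabulate (xCol n)) (thereᵥ (concat⁺
    (Anyᵥ.map (λ eq → subst (u ∈ᵥ_) eq u∈g) (∈-map⁺ gateColumns (∈-fromList⁺ g∈gs)))))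

  formula : Bool → Expr (n + k)
  formula b = consistentAnd (polarity b (var r))

  formula-sound : ∀ b x y → lookup (x ++ y) ⊨ formula b → f x ≡ b
  formula-sound b x y h = begin
    f x                          ≡⟨ cong f w-x ⟨
    f (tabulate (w ∘ xCol n))    ≡⟨ ¬≢⇒≡ w∉PolBar ⟨
    w (rCol n f)                 ≡⟨ extend-lookup pp lookup-r ⟩
    lookup (x ++ y) r            ≡⟨ Equivalence.to (⊨-polarity-var b r _) base ⟩
    b                            ∎
    where
    open ≡-Reasoning
    pp = proj₁ (Equivalence.to (⊨-consistentAnd (x ++ y) _) h)
    base = proj₂ (Equivalence.to (⊨-consistentAnd (x ++ y) _) h)
    w = extend (x ++ y)
    w-x : tabulate (w ∘ xCol n) ≡ x
    w-x = trans (tabulate-cong λ i → trans (extend-lookup pp (lookup-x i)) (lookup-++ˡ x y i)) (tabulate∘lookup x)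
    w∉PolBar : ¬ InPolBar n f w
    w∉PolBar bar = let g , g∈gs , covered = cover w bar in
      extend-uncovered columns pp g (gateColumns-∈ g∈gs) covered

  formula-complete : ∀ b x → f x ≡ b → Σ (Vec Bool k) λ y → lookup (x ++ y) ⊨ formula b
  formula-complete b x fx≡b = y , Equivalence.from (⊨-consistentAnd (x ++ y) _) (pp , base)
    where
    open ≡-Reasoning
    x∈rows = ∈-rows x
    ρ = index x∈rows
    y = rowAt ρ guessedColumns
    row-columns : rowAt ρ columns ≡ x ++ y
    row-columns = trans (map-++ _ (tabulate (xCol n)) guessedColumns)
      (cong (_++ y) (trans (rowAt-columnsOf (λ a → a) ρ) (sym (lookup-index x∈rows))))
    pp : IsPartialPol (x ++ y)
    pp = subst IsPartialPol row-columns (row-isPartialPol ρ)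
    base : lookup (x ++ y) ⊨ polarity b (var r)
    base = Equivalence.from (⊨-polarity-var b r _) (begin
      lookup (x ++ y) r               ≡⟨ cong (λ v → lookup v r) row-columns ⟨
      lookup (rowAt ρ columns) r      ≡⟨ lookup-map r (λ u → lookup u ρ) columns ⟩
      lookup (lookup columns r) ρ     ≡⟨ cong (λ u → lookup u ρ) lookup-r ⟩
      lookup (rCol n f) ρ             ≡⟨ lookup-map ρ f (rows n) ⟩
      f (lookup (rows n) ρ)           ≡⟨ cong f (lookup-index x∈rows) ⟨
      f x                             ≡⟨ fx≡b ⟩
      b                               ∎)

  certifier : ∀ b → Certifier b f (certifierSize (n + k))
  certifier b = k , compile (polarity b (formula b)) , +-mono-≤ size-bound (m≤n+m k n) ,
    formula⇒certifies (formula b) (λ x → mk⇔ (formula-complete b x) (λ (y , h) → formula-sound b x y h))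
    where
    open ≤-Reasoning
    size-bound : size (compile (polarity b (formula b))) ≤ suc (consistencyCost (n + k) + 1)
    size-bound = begin
      size (compile (polarity b (formula b)))                   ≡⟨ size-compile (polarity b (formula b)) ⟩
      cost (polarity b (formula b))                             ≤⟨ cost-polarity b (formula b) ⟩
      suc (cost (formula b))                                    ≤⟨ s≤s (cost-consistentAnd (polarity b (var r))) ⟩
      suc (consistencyCost (n + k) + cost (polarity b (var r)))  ≤⟨ s≤s (+-monoʳ-≤ _ (cost-polarity b (var r))) ⟩
      suc (consistencyCost (n + k) + 1)                         ∎

cover⇒certifier : ∀ {n} {f : Vec Bool n → Bool} {s} →
  TSize≤ n f s → ∀ b → Certifier b f (certifierSize (n + suc (s * 3)))
cover⇒certifier {n} (gs , cover , length≤s) b =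
  Certifier-mono (certifierSize-mono (+-monoʳ-≤ n (s≤s (*-monoˡ-≤ 3 length≤s))))
    (PolCoverCertificate.certifier cover b)

mainTheorem8 : (L : Language) →
    (InNPpoly L × InCoNPpoly L) ⇔
    (Σ Poly λ p → (n : ℕ) → TSize≤ n (charFun L n) (evalPoly p n))
mainTheorem8 L = mk⇔ cover certifiers
  where
  cover : InNPpoly L × InCoNPpoly L → Σ Poly λ p → ∀ n → TSize≤ n (charFun L n) (evalPoly p n)
  cover ((p , np) , (p' , conp)) =
    polyBounded⇒poly (λ n → TSize≤ n (charFun L n)) TSize≤-mono
      (λ n → certifiers⇒cover (np n) (conp n))
      (polyBounded-+ (polyBounded-evalPoly p) (polyBounded-evalPoly p'))

  certifiers : (Σ Poly λ p → ∀ n → TSize≤ n (charFun L n) (evalPoly p n)) → InNPpoly L × InCoNPpoly L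
  certifiers (q , covers) = certifier true , certifier false
    where
    variables-bounded : PolyBounded (λ n → n + suc (evalPoly q n * 3))
    variables-bounded = polyBounded-+ polyBounded-id
      (polyBounded-+ (polyBounded-const 1) (polyBounded-* (polyBounded-evalPoly q) (polyBounded-const 3)))
    certifier : ∀ b → Σ Poly λ p → ∀ n → Certifier b (charFun L n) (evalPoly p n)
    certifier b = polyBounded⇒poly (λ n → Certifier b (charFun L n)) Certifier-mono
      (λ n → cover⇒certifier (covers n) b) (polyBounded-certifierSize variables-bounded)
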